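{- Let $G$ be a split graph and fix a partition $V(G)=K\cup S$ with $K$ a clique, $S$ a stable set and $|S|=\alpha(G)$. Let $H$ be the $XY$-graph with $X=S$, $Y=K$ and edge set $\{xy\in E(G): x\in S,\ y\in K\}$. Then $H$ is an $XY$-graph with no isolates in $Y$, and $H$ is unbalanced if and only if $G$ is an unbalanced split graph (equivalently, $H$ is balanced if and only if $G$ is balanced).
   Context: A finite graph $G$ is a split graph if its vertex set can be partitioned as $K\cup S$ with $K$ a clique and $S$ a stable set (a $KS$-partition). With $\omega(G)$ the clique number and $\alpha(G)$ the independence number, a split graph is balanced if it has a $KS$-partition with $|K|=\omega(G)$ and $|S|=\alpha(G)$, and unbalanced otherwise. An $XY$-graph is a bipartite graph with a specified ordered bipartition $X\cup Y$ of its vertices (edges join $X$ to $Y$). A vertex of $Y$ is an isolate if it has no neighbor; a vertex of $X$ is universal if it is adjacent to every vertex of $Y$. An $XY$-graph with no isolates in $Y$ is unbalanced if $X$ contains a universal vertex, and balanced otherwise. -}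

module Defs where

open import Data.Nat using (ℕ; _≤_)
open import Data.Fin using (Fin)
open import Data.Bool using (Bool; true; false)
open import Data.Fin.Subset using (Subset; _∈_; _∉_; ∣_∣)
open import Data.Product using (Σ; ∃; _×_; _,_)
open import Data.Sum using (_⊎_)
open import Relation.Nullary using (¬_)
open import Relation.Binary.PropositionalEquality using (_≡_; _≢_)
open import Level using (Level; suc; _⊔_)

record Graph (n : ℕ) : Set where
  field
    adj     : Fin n → Fin n → Bool
    adj-sym : ∀ u v → adj u v ≡ adj v u
    adj-irr : ∀ v → adj v v ≡ false

module _ {n : ℕ} (G : Graph n) where
  open Graph G

  Adj : Fin n → Fin n → Set
  Adj u v = adj u v ≡ true

  IsClique : Subset n → Set
  IsClique K = ∀ u v → u ∈ K → v ∈ K → u ≢ v → Adj u v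

  IsStable : Subset n → Set
  IsStable S = ∀ u v → u ∈ S → v ∈ S → ¬ Adj u v

  IsCliqueNumber : ℕ → Set
  IsCliqueNumber w = (Σ (Subset n) λ K → IsClique K × ∣ K ∣ ≡ w)
                   × (∀ K → IsClique K → ∣ K ∣ ≤ w)

  IsIndepNumber : ℕ → Set
  IsIndepNumber a = (Σ (Subset n) λ S → IsStable S × ∣ S ∣ ≡ a)
                  × (∀ S → IsStable S → ∣ S ∣ ≤ a)

  IsKSPartition : Subset n → Subset n → Set
  IsKSPartition K S = (∀ v → v ∈ K ⊎ v ∈ S)
                    × (∀ v → v ∈ K → v ∉ S)
                    × IsClique K × IsStable S

  IsSplit : Set
  IsSplit = Σ (Subset n) λ K → Σ (Subset n) λ S → IsKSPartition K S

  BalancedSplit : Set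
  BalancedSplit = Σ (Subset n) λ K → Σ (Subset n) λ S →
                    IsKSPartition K S × IsCliqueNumber ∣ K ∣ × IsIndepNumber ∣ S ∣

  UnbalancedSplit : Set
  UnbalancedSplit = IsSplit × ¬ BalancedSplit

record XYGraph : Set₁ where
  field
    X    : Set
    Y    : Set
    edge : X → Y → Set

module _ (H : XYGraph) where
  open XYGraph H

  IsIsolate : Y → Set
  IsIsolate y = ∀ x → ¬ edge x y

  NoIsolates : Set
  NoIsolates = ∀ y → ¬ IsIsolate y

  IsUniversal : X → Set
  IsUniversal x = ∀ y → edge x y

  UnbalancedXY : Set
  UnbalancedXY = Σ X IsUniversal

  BalancedXY : Set
  BalancedXY = ¬ UnbalancedXY

toXY : {n : ℕ} → Graph n → Subset n → Subset n → XYGraph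
toXY G K S = record
  { X    = Σ (Fin _) (λ x → x ∈ S)
  ; Y    = Σ (Fin _) (λ y → y ∈ K)
  ; edge = λ { (x , _) (y , _) → Adj G x y }
  }

module Submission where

-- The proof compares |K| + |S| = n with
-- ω(G) + α(G):
--   * a vertex of K with no neighbour in S could be added to S, contradicting
--     |S| = α(G); so Y has no isolates;
--   * a vertex x ∈ S complete to K (a universal vertex of H) makes K ∪ {x} a
--     clique, so ω(G) + α(G) > |K| + |S| = n, while every KS-partition has
--     |K'| + |S'| = n; hence no KS-partition is balanced;
--   * if every x ∈ S has a non-neighbour y ∈ K, every clique C has |C| ≤ |K|
--     (C lies in K ∪ {x} for the one possible x ∈ C ∩ S, and misses y), so
--     (K , S) itself is balanced.
-- Universality is decidable on a finite graph, which yields both equivalences.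

open import Defs
open import Data.Nat using (ℕ; suc; _≤_; _<_; _+_; _∸_; z≤n; s≤s)
open import Data.Nat.Properties
  using (≤-antisym; ≤-trans; ≤-reflexive; n≤1+n; +-suc; +-comm; +-mono-≤; +-monoʳ-≤;
         +-monoˡ-<; m+[n∸m]≡n; m<1+n⇒m≤n; <-irrefl; <⇒≱; module ≤-Reasoning)
open import Data.Fin using (Fin) renaming (_≟_ to _≟ᶠ_)
open import Data.Fin.Properties using (any?; all?)
open import Data.Fin.Subset using (Subset; ∣_∣; _∈_; _∉_; _⊆_; _∪_; ⁅_⁆; ∁; inside; outside)
open import Data.Fin.Subset.Properties
  using (_∈?_; p⊆q⇒∣p∣≤∣q∣; p⊂q⇒∣p∣<∣q∣; p⊆p∪q; x∈p∪q⁺; x∈p∪q⁻; x∈⁅x⁆; x∈⁅y⁆⇒x≡y;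
         ∣⁅x⁆∣≡1; ∣p∣≤n; ∣∁p∣≡n∸∣p∣; x∉p⇒x∈∁p; x∈∁p⇒x∉p)
open import Data.Vec using ([]; _∷_)
open import Data.Bool using (true) renaming (_≟_ to _≟ᵇ_)
open import Data.Product using (∃; _×_; _,_)
open import Data.Sum using (_⊎_; inj₁; inj₂; [_,_]′)
import Data.Sum as Sum
open import Data.Empty using (⊥-elim)
open import Function using (id)
open import Function.Bundles using (_⇔_; mk⇔)
open import Relation.Nullary using (¬_; Dec; yes; no)
open import Relation.Nullary.Decidable.Core using (_×-dec_; _→-dec_; ¬?; decidable-stable)
open import Relation.Binary.PropositionalEquality using (_≡_; refl; sym; trans; cong; module ≡-Reasoning)

∣p∪q∣≤∣p∣+∣q∣ : ∀ {m} (p q : Subset m) → ∣ p ∪ q ∣ ≤ ∣ p ∣ + ∣ q ∣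
∣p∪q∣≤∣p∣+∣q∣ []            []            = z≤n
∣p∪q∣≤∣p∣+∣q∣ (inside ∷ p)  (inside ∷ q)  =
  s≤s (≤-trans (∣p∪q∣≤∣p∣+∣q∣ p q) (+-monoʳ-≤ ∣ p ∣ (n≤1+n ∣ q ∣)))
∣p∪q∣≤∣p∣+∣q∣ (inside ∷ p)  (outside ∷ q) = s≤s (∣p∪q∣≤∣p∣+∣q∣ p q)
∣p∪q∣≤∣p∣+∣q∣ (outside ∷ p) (inside ∷ q)  =
  ≤-trans (s≤s (∣p∪q∣≤∣p∣+∣q∣ p q)) (≤-reflexive (sym (+-suc ∣ p ∣ ∣ q ∣)))
∣p∪q∣≤∣p∣+∣q∣ (outside ∷ p) (outside ∷ q) = ∣p∪q∣≤∣p∣+∣q∣ p q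

∣p∪⁅x⁆∣≤1+∣p∣ : ∀ {m} (p : Subset m) (x : Fin m) → ∣ p ∪ ⁅ x ⁆ ∣ ≤ suc ∣ p ∣
∣p∪⁅x⁆∣≤1+∣p∣ p x = ≤-trans (∣p∪q∣≤∣p∣+∣q∣ p ⁅ x ⁆)
  (≤-reflexive (trans (cong (∣ p ∣ +_) (∣⁅x⁆∣≡1 x)) (+-comm ∣ p ∣ 1)))

x∉p⇒∣p∣<∣p∪⁅x⁆∣ : ∀ {m} {p : Subset m} {x : Fin m} → x ∉ p → ∣ p ∣ < ∣ p ∪ ⁅ x ⁆ ∣
x∉p⇒∣p∣<∣p∪⁅x⁆∣ {x = x} x∉p = p⊂q⇒∣p∣<∣q∣ (p⊆p∪q ⁅ x ⁆ , x , x∈p∪q⁺ (inj₂ (x∈⁅x⁆ x)) , x∉p)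

∈-∪⁅⁆⁻ : ∀ {m} (p : Subset m) (x : Fin m) {v : Fin m} → v ∈ p ∪ ⁅ x ⁆ → v ∈ p ⊎ v ≡ x
∈-∪⁅⁆⁻ p x v∈ = Sum.map₂ (x∈⁅y⁆⇒x≡y x) (x∈p∪q⁻ p ⁅ x ⁆ v∈)

partition-size : ∀ {m} (A B : Subset m) → (∀ v → v ∈ A ⊎ v ∈ B) → (∀ v → v ∈ A → v ∉ B) →
                 ∣ A ∣ + ∣ B ∣ ≡ m
partition-size {m} A B cover disjoint = begin
  ∣ A ∣ + ∣ B ∣       ≡⟨ cong (∣ A ∣ +_) ∣B∣≡∣∁A∣ ⟩
  ∣ A ∣ + ∣ ∁ A ∣     ≡⟨ cong (∣ A ∣ +_) (∣∁p∣≡n∸∣p∣ A) ⟩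
  ∣ A ∣ + (m ∸ ∣ A ∣) ≡⟨ m+[n∸m]≡n (∣p∣≤n A) ⟩
  m                   ∎
  where
  open ≡-Reasoning
  B⊆∁A : B ⊆ ∁ A
  B⊆∁A {v} v∈B = x∉p⇒x∈∁p (λ v∈A → disjoint v v∈A v∈B)
  ∁A⊆B : ∁ A ⊆ B
  ∁A⊆B {v} v∈∁A = [ (λ v∈A → ⊥-elim (x∈∁p⇒x∉p v∈∁A v∈A)) , id ]′ (cover v)
  ∣B∣≡∣∁A∣ : ∣ B ∣ ≡ ∣ ∁ A ∣
  ∣B∣≡∣∁A∣ = ≤-antisym (p⊆q⇒∣p∣≤∣q∣ B⊆∁A) (p⊆q⇒∣p∣≤∣q∣ ∁A⊆B)

module _ {n : ℕ} (G : Graph n) where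
  open Graph G

  Adj-sym : ∀ {u v} → Adj G u v → Adj G v u
  Adj-sym {u} {v} u~v = trans (adj-sym v u) u~v

  Adj-irrefl : ∀ {v} → ¬ Adj G v v
  Adj-irrefl {v} v~v with trans (sym v~v) (adj-irr v)
  ... | ()

  Adj? : ∀ u v → Dec (Adj G u v)
  Adj? u v = adj u v ≟ᵇ true

  stable-∪⁅⁆ : ∀ {S y} → IsStable G S → (∀ v → v ∈ S → ¬ Adj G y v) → IsStable G (S ∪ ⁅ y ⁆)
  stable-∪⁅⁆ {S} {y} S-stable y≁S u v u∈ v∈ with ∈-∪⁅⁆⁻ S y u∈ | ∈-∪⁅⁆⁻ S y v∈
  ... | inj₁ u∈S | inj₁ v∈S = S-stable u v u∈S v∈S
  ... | inj₁ u∈S | inj₂ refl = λ u~y → y≁S u u∈S (Adj-sym u~y)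
  ... | inj₂ refl | inj₁ v∈S = y≁S v v∈S
  ... | inj₂ refl | inj₂ refl = Adj-irrefl

  clique-∪⁅⁆ : ∀ {C x} → IsClique G C → (∀ v → v ∈ C → Adj G x v) → IsClique G (C ∪ ⁅ x ⁆)
  clique-∪⁅⁆ {C} {x} C-clique x~C u v u∈ v∈ u≢v with ∈-∪⁅⁆⁻ C x u∈ | ∈-∪⁅⁆⁻ C x v∈
  ... | inj₁ u∈C | inj₁ v∈C = C-clique u v u∈C v∈C u≢v
  ... | inj₁ u∈C | inj₂ refl = Adj-sym (x~C u u∈C)
  ... | inj₂ refl | inj₁ v∈C = x~C v v∈C
  ... | inj₂ refl | inj₂ refl = ⊥-elim (u≢v refl)

  clique∩stable-unique : ∀ {C S u v} → IsClique G C → IsStable G S →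
                         u ∈ C → u ∈ S → v ∈ C → v ∈ S → u ≡ v
  clique∩stable-unique {u = u} {v} C-clique S-stable u∈C u∈S v∈C v∈S with u ≟ᶠ v
  ... | yes u≡v = u≡v
  ... | no u≢v  = ⊥-elim (S-stable u v u∈S v∈S (C-clique u v u∈C v∈C u≢v))

  KS-partition-size : ∀ {K S} → IsKSPartition G K S → ∣ K ∣ + ∣ S ∣ ≡ n
  KS-partition-size {K} {S} (cover , disjoint , _ , _) = partition-size K S cover disjoint

module KSPartition {n : ℕ} (G : Graph n) {K S : Subset n} (part : IsKSPartition G K S) where
  private
    H : XYGraph
    H = toXY G K S

  cover : ∀ v → v ∈ K ⊎ v ∈ S
  cover = let (c , _ , _ , _) = part in c

  disjoint : ∀ v → v ∈ K → v ∉ S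
  disjoint = let (_ , d , _ , _) = part in d

  K-clique : IsClique G K
  K-clique = let (_ , _ , k , _) = part in k

  S-stable : IsStable G S
  S-stable = let (_ , _ , _ , s) = part in s

  clique-⊆-K∪⁅⁆ : ∀ {C x} → IsClique G C → x ∈ C → x ∈ S → C ⊆ K ∪ ⁅ x ⁆
  clique-⊆-K∪⁅⁆ {C} {x} C-clique x∈C x∈S {v} v∈C = x∈p∪q⁺ (Sum.map₂ v≡x (cover v))
    where
    v≡x : v ∈ S → v ∈ ⁅ x ⁆
    v≡x v∈S with clique∩stable-unique G C-clique S-stable v∈C v∈S x∈C x∈S
    ... | refl = x∈⁅x⁆ x

  -- A clique through x ∈ S misses every non-neighbour y ∈ K of x, so it is
  -- strictly smaller than K ∪ {x}.
  clique-bound-through : ∀ {C x y} → IsClique G C → x ∈ C → x ∈ S →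
                         y ∈ K → ¬ Adj G x y → ∣ C ∣ ≤ ∣ K ∣
  clique-bound-through {C} {x} {y} C-clique x∈C x∈S y∈K x≁y = m<1+n⇒m≤n (begin-strict
    ∣ C ∣           <⟨ p⊂q⇒∣p∣<∣q∣ (clique-⊆-K∪⁅⁆ C-clique x∈C x∈S , y , x∈p∪q⁺ (inj₁ y∈K) , y∉C) ⟩
    ∣ K ∪ ⁅ x ⁆ ∣   ≤⟨ ∣p∪⁅x⁆∣≤1+∣p∣ K x ⟩
    suc ∣ K ∣       ∎)
    where
    open ≤-Reasoning
    y∉C : y ∉ C
    y∉C y∈C with x ≟ᶠ y
    ... | yes refl = disjoint x y∈K x∈S
    ... | no x≢y   = x≁y (C-clique x y x∈C y∈C x≢y)

  clique-bound : (∀ x → x ∈ S → ∃ λ y → y ∈ K × ¬ Adj G x y) →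
                 ∀ C → IsClique G C → ∣ C ∣ ≤ ∣ K ∣
  clique-bound non-neighbour C C-clique with any? (λ v → (v ∈? C) ×-dec (v ∈? S))
  ... | yes (x , x∈C , x∈S) =
    let (y , y∈K , x≁y) = non-neighbour x x∈S
    in  clique-bound-through C-clique x∈C x∈S y∈K x≁y
  ... | no C∩S-empty = p⊆q⇒∣p∣≤∣q∣ C⊆K
    where
    C⊆K : C ⊆ K
    C⊆K {v} v∈C = [ id , (λ v∈S → ⊥-elim (C∩S-empty (v , v∈C , v∈S))) ]′ (cover v)

  universal? : Dec (UnbalancedXY H)
  universal? with any? (λ x → (x ∈? S) ×-dec all? (λ y → (y ∈? K) →-dec Adj? G x y))
  ... | yes (x , x∈S , x~K) = yes ((x , x∈S) , λ (y , y∈K) → x~K y y∈K)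
  ... | no none = no λ ((x , x∈S) , x~K) → none (x , x∈S , λ y y∈K → x~K (y , y∈K))

  non-neighbour : ¬ UnbalancedXY H → ∀ x → x ∈ S → ∃ λ y → y ∈ K × ¬ Adj G x y
  non-neighbour no-universal x x∈S with any? (λ y → (y ∈? K) ×-dec ¬? (Adj? G x y))
  ... | yes witness = witness
  ... | no none = ⊥-elim (no-universal ((x , x∈S) , λ (y , y∈K) →
                    decidable-stable (Adj? G x y) (λ x≁y → none (y , y∈K , x≁y))))

  -- With |S| = α(G), every vertex y ∈ K has a neighbour in S: otherwise
  -- S ∪ {y} would be a larger stable set.
  no-isolates : IsIndepNumber G ∣ S ∣ → NoIsolates H
  no-isolates (_ , α-max) (y , y∈K) isolated =
    <⇒≱ (x∉p⇒∣p∣<∣p∪⁅x⁆∣ (disjoint y y∈K)) (α-max (S ∪ ⁅ y ⁆) S∪⁅y⁆-stable)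
    where
    S∪⁅y⁆-stable : IsStable G (S ∪ ⁅ y ⁆)
    S∪⁅y⁆-stable = stable-∪⁅⁆ G S-stable (λ v v∈S y~v → isolated (v , v∈S) (Adj-sym G y~v))

  -- A universal vertex x of H makes K ∪ {x} a clique, so any KS-partition
  -- (K' , S') with |K'| = ω(G), |S'| = α(G) would give n < |K'| + |S'| = n.
  universal⇒unbalanced : UnbalancedXY H → ¬ BalancedSplit G
  universal⇒unbalanced ((x , x∈S) , x~K) (K' , S' , part' , (_ , ω-max) , (_ , α-max)) =
    <-irrefl refl (begin-strict
      n                       ≡⟨ sym (KS-partition-size G part) ⟩
      ∣ K ∣ + ∣ S ∣           <⟨ +-monoˡ-< ∣ S ∣ (x∉p⇒∣p∣<∣p∪⁅x⁆∣ (λ x∈K → disjoint x x∈K x∈S)) ⟩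
      ∣ K ∪ ⁅ x ⁆ ∣ + ∣ S ∣   ≤⟨ +-mono-≤ (ω-max (K ∪ ⁅ x ⁆) K∪⁅x⁆-clique) (α-max S S-stable) ⟩
      ∣ K' ∣ + ∣ S' ∣         ≡⟨ KS-partition-size G part' ⟩
      n                       ∎)
    where
    open ≤-Reasoning
    K∪⁅x⁆-clique : IsClique G (K ∪ ⁅ x ⁆)
    K∪⁅x⁆-clique = clique-∪⁅⁆ G K-clique (λ y y∈K → x~K (y , y∈K))

  non-universal⇒balanced : IsIndepNumber G ∣ S ∣ → ¬ UnbalancedXY H → BalancedSplit G
  non-universal⇒balanced α-S no-universal =
    K , S , part , ((K , K-clique , refl) , clique-bound (non-neighbour no-universal)) , α-S

  unbalanced⇒universal : IsIndepNumber G ∣ S ∣ → ¬ BalancedSplit G → UnbalancedXY H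
  unbalanced⇒universal α-S not-balanced with universal?
  ... | yes universal   = universal
  ... | no no-universal = ⊥-elim (not-balanced (non-universal⇒balanced α-S no-universal))

theorem3p5 : (n : ℕ) (G : Graph n) (K S : Subset n) →
    IsKSPartition G K S → IsIndepNumber G ∣ S ∣ →
    NoIsolates (toXY G K S)
    × (UnbalancedXY (toXY G K S) ⇔ UnbalancedSplit G)
    × (BalancedXY (toXY G K S) ⇔ BalancedSplit G)
theorem3p5 n G K S part α-S =
    no-isolates α-S
  , mk⇔ (λ universal → (K , S , part) , universal⇒unbalanced universal)
        (λ (_ , not-balanced) → unbalanced⇒universal α-S not-balanced)
  , mk⇔ (non-universal⇒balanced α-S)
        (λ balanced universal → universal⇒unbalanced universal balanced)
  where open KSPartition G part
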